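{- Let $\Phi=(V,\mathscr{C})$ be a hypergraph with $V=[n]$, let $T\in\mathbb{N}$, let $R_1,\dots,R_T\in\{0,1\}$, and define $X_{\sigma,t}:=F(\sigma;R_1,\dots,R_t)$ for $\sigma\in\Omega_\Phi$, $0\le t\le T$, and $Y_0:=\{1\}^V$, $Y_t:=Y_{t-1}^{v_t\gets R_t}$ for $1\le t\le T$. Let $1\le t\le T$. If there exist $\sigma,\tau\in\Omega_\Phi$ with $X_{\sigma,t}(v_t)\neq X_{\tau,t}(v_t)$, then there is a hyperedge $C\in\mathscr{C}$ containing $v_t$ such that $C\setminus\{v_t\}$ is colored entirely by $1$ in exactly one of $X_{\sigma,t}$ and $X_{\tau,t}$. Furthermore, $Y_t(C)=\{1\}^C$, i.e. $Y_t(w)=1$ for all $w\in C$.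
   Context: $\Phi=(V,\mathscr{C})$ has vertex set $V=[n]$ and hyperedges $\mathscr{C}$ (nonempty subsets of $V$). A coloring $\sigma\in\{0,1\}^V$ is an independent set if every $C\in\mathscr{C}$ contains some $v$ with $\sigma(v)=0$; $\Omega_\Phi$ is the set of independent sets. $\sigma^{v\gets r}$ denotes $\sigma$ with the value at $v$ replaced by $r$. $f(\sigma;v,r):=\sigma^{v\gets r}$ if $\sigma^{v\gets r}\in\Omega_\Phi$, else $f(\sigma;v,r):=\sigma$. The scan sequence is $v_i:=(i\bmod n)+1$, and $F(\sigma;r_1,\dots,r_t):=f(f(\cdots f(\sigma;v_1,r_1)\cdots);v_t,r_t)$. -}

module Defs where

open import Data.Bool using (Bool; true; false; if_then_else_)
open import Data.Nat using (ℕ; zero; suc; NonZero)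
open import Data.Nat.DivMod using (_%_; m%n<n)
open import Data.Fin using (Fin; fromℕ<; _≟_)
open import Data.Fin.Subset using (Subset; _∈_; Nonempty)
open import Data.Fin.Subset.Properties using (_∈?_)
open import Data.Fin.Properties using (any?)
open import Data.List using (List; []; _∷_)
open import Data.List.Relation.Unary.All using (All; all?)
open import Data.Product using (∃; _×_)
open import Relation.Binary.PropositionalEquality using (_≡_)
open import Relation.Nullary using (Dec; does; ¬_)
open import Relation.Nullary.Decidable using (_×-dec_)
import Data.Bool.Properties as BP

-- Vertex set V = [n] is represented by Fin n (vertex k+1 of the paper is 'k : Fin n').
-- A hypergraph: a finite list of hyperedges, each a subset of Fin n.
record Hypergraph (n : ℕ) : Set where
  field
    edges    : List (Subset n)
    nonempty : All Nonempty edges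
open Hypergraph public

-- colorings σ ∈ {0,1}^V ; 'false' = 0, 'true' = 1
Coloring : ℕ → Set
Coloring n = Fin n → Bool

IsIndep : ∀ {n} → Hypergraph n → Coloring n → Set
IsIndep Φ σ = All (λ C → ∃ λ v → v ∈ C × σ v ≡ false) (edges Φ)

isIndep? : ∀ {n} (Φ : Hypergraph n) (σ : Coloring n) → Dec (IsIndep Φ σ)
isIndep? Φ σ = all? (λ C → any? (λ v → (v ∈? C) ×-dec (σ v BP.≟ false))) (edges Φ)

update : ∀ {n} → Coloring n → Fin n → Bool → Coloring n
update σ v r w = if does (w ≟ v) then r else σ w

step : ∀ {n} → Hypergraph n → Coloring n → Fin n → Bool → Coloring n
step Φ σ v r = if does (isIndep? Φ (update σ v r)) then update σ v r else σ

-- scan sequence v_i = (i mod n) + 1 ; as an element of Fin n this is i mod n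
scan : ∀ n → .{{_ : NonZero n}} → ℕ → Fin n
scan n i = fromℕ< (m%n<n i n)

Fᵢ : ∀ {n} .{{_ : NonZero n}} → Hypergraph n → ℕ → Coloring n → List Bool → Coloring n
Fᵢ Φ i σ [] = σ
Fᵢ {n} Φ i σ (r ∷ rs) = Fᵢ Φ (suc i) (step Φ σ (scan n i) r) rs

F : ∀ {n} .{{_ : NonZero n}} → Hypergraph n → Coloring n → List Bool → Coloring n
F Φ σ rs = Fᵢ Φ 1 σ rs

Yᵢ : ∀ {n} .{{_ : NonZero n}} → ℕ → Coloring n → List Bool → Coloring n
Yᵢ i σ [] = σ
Yᵢ {n} i σ (r ∷ rs) = Yᵢ (suc i) (update σ (scan n i) r) rs

Y : ∀ {n} .{{_ : NonZero n}} → List Bool → Coloring n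
Y rs = Yᵢ 1 (λ _ → true) rs

AllOnesExcept : ∀ {n} → Coloring n → Subset n → Fin n → Set
AllOnesExcept σ C v = ∀ w → w ∈ C → ¬ (w ≡ v) → σ w ≡ true

-- Setting a vertex to 0 never breaks independence, so a disagreement at v_t after step t
-- forces R_t = 1, with the update v_t ← 1 accepted in one chain and rejected in the other.
-- The rejecting chain has an edge C that the update would turn all 1; since that chain is
-- independent, C ∋ v_t and C ∖ {v_t} is all 1 in it, while in the accepting chain C still
-- has a 0, necessarily off v_t. Every chain is pointwise below Y (a rejected update leaves
-- a value that Y dominates anyway), so Y_t is 1 on C.
{-# OPTIONS --safe #-}
module Submission where

open import Defs
open import Data.Bool using (Bool; true; false; if_then_else_)
open import Data.Bool.Properties using (¬-not) renaming (_≟_ to _≟ᵇ_)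
open import Data.Nat using (ℕ; _≤_; NonZero; suc; _+_; _⊓_; s≤s; z≤n)
open import Data.Nat.Properties using (+-suc; +-comm; m≤n⇒m⊓n≡m)
open import Data.Fin using (Fin; _≟_)
open import Data.Fin.Subset using (Subset; _∈_)
open import Data.Fin.Subset.Properties using (_∈?_)
open import Data.Fin.Properties using (any?)
open import Data.Vec using (Vec; _∷_; toList)
open import Data.Vec.Properties using (length-toList)
open import Data.List using ([]; _∷_; take; length)
open import Data.List.Properties using (length-take)
open import Data.List.Membership.Propositional using (find) renaming (_∈_ to _∈ₗ_)
import Data.List.Relation.Unary.All as All
open import Data.List.Relation.Unary.All.Properties.Core using (¬All⇒Any¬)
open import Data.Product using (∃; _×_; _,_)
open import Data.Sum using (_⊎_; inj₁; inj₂)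
open import Relation.Nullary using (¬_; yes; no; does; contradiction)
open import Relation.Nullary.Decidable using (_×-dec_; dec-true; dec-false)
open import Relation.Binary.PropositionalEquality
open import Function using (_∘_)

length-take-toList : ∀ {a} {A : Set a} {m k} → k ≤ m → (xs : Vec A m) →
                     length (take k (toList xs)) ≡ k
length-take-toList {m = m} {k} k≤m xs = begin
  length (take k (toList xs))  ≡⟨ length-take k (toList xs) ⟩
  k ⊓ length (toList xs)       ≡⟨ cong (k ⊓_) (length-toList xs) ⟩
  k ⊓ m                        ≡⟨ m≤n⇒m⊓n≡m k≤m ⟩
  k                            ∎
  where open ≡-Reasoning

infix 4 _⊑_

_⊑_ : ∀ {n} → Coloring n → Coloring n → Set
σ ⊑ ρ = ∀ w → σ w ≡ true → ρ w ≡ true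

module _ {n : ℕ} where

  update-same : (σ : Coloring n) (v : Fin n) (r : Bool) → update σ v r v ≡ r
  update-same σ v r with v ≟ v
  ... | yes _ = refl
  ... | no v≢v = contradiction refl v≢v

  update-other : (σ : Coloring n) {v w : Fin n} (r : Bool) → w ≢ v → update σ v r w ≡ σ w
  update-other σ {v} {w} r w≢v with w ≟ v
  ... | yes w≡v = contradiction w≡v w≢v
  ... | no _ = refl

  update-mono : {σ ρ : Coloring n} (v : Fin n) (r : Bool) → σ ⊑ ρ → update σ v r ⊑ update ρ v r
  update-mono v r σ⊑ρ w with does (w ≟ v)
  ... | true = λ r≡true → r≡true
  ... | false = σ⊑ρ w

  ⊑-update-true : (σ : Coloring n) (v : Fin n) → σ ⊑ update σ v true
  ⊑-update-true σ v w with does (w ≟ v)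
  ... | true = λ _ → refl
  ... | false = λ σw≡true → σw≡true

module _ {n : ℕ} (Φ : Hypergraph n) where

  AllOnesOn : Coloring n → Subset n → Set
  AllOnesOn σ C = ∀ w → w ∈ C → σ w ≡ true

  ¬indep⇒all-ones-edge : ∀ {σ} → ¬ IsIndep Φ σ → ∃ λ C → C ∈ₗ edges Φ × AllOnesOn σ C
  ¬indep⇒all-ones-edge {σ} ¬indep with find (¬All⇒Any¬ has-zero? (edges Φ) ¬indep)
    where has-zero? = λ C → any? (λ u → (u ∈? C) ×-dec (σ u ≟ᵇ false))
  ... | C , C∈Φ , no-zero =
    C , C∈Φ , λ w w∈C → ¬-not (λ σw≡false → no-zero (w , w∈C , σw≡false))

  update-indep : ∀ {σ v r} →
    IsIndep Φ σ → (σ v ≡ false → r ≡ false) → IsIndep Φ (update σ v r)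
  update-indep {σ} {v} {r} indep r≤σv = All.map keep-zero indep
    where
    keep-zero : ∀ {C} → ∃ (λ u → u ∈ C × σ u ≡ false) →
                ∃ (λ u → u ∈ C × update σ v r u ≡ false)
    keep-zero (u , u∈C , σu≡false) with u ≟ v
    ... | yes refl = u , u∈C , trans (update-same σ u r) (r≤σv σu≡false)
    ... | no u≢v = u , u∈C , trans (update-other σ r u≢v) σu≡false

  rejected⇒false : ∀ {σ v} → IsIndep Φ σ → ¬ IsIndep Φ (update σ v true) → σ v ≡ false
  rejected⇒false {σ} {v} indep ¬indep with σ v in σv
  ... | false = refl
  ... | true = contradiction (update-indep indep (λ σv≡false → trans (sym σv) σv≡false)) ¬indep

  data StepView (σ : Coloring n) (v : Fin n) (r : Bool) : Set where
    accepted : IsIndep Φ (update σ v r) → step Φ σ v r ≡ update σ v r → StepView σ v r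
    rejected : ¬ IsIndep Φ (update σ v r) → step Φ σ v r ≡ σ → StepView σ v r

  stepView : (σ : Coloring n) (v : Fin n) (r : Bool) → StepView σ v r
  stepView σ v r with isIndep? Φ (update σ v r)
  ... | yes indep =
    accepted indep (cong (if_then update σ v r else σ) (dec-true (isIndep? Φ _) indep))
  ... | no ¬indep =
    rejected ¬indep (cong (if_then update σ v r else σ) (dec-false (isIndep? Φ _) ¬indep))

  step-false : ∀ {σ} v → IsIndep Φ σ → step Φ σ v false ≡ update σ v false
  step-false {σ} v indep with stepView σ v false
  ... | accepted _ eq = eq
  ... | rejected ¬indep _ = contradiction (update-indep indep (λ _ → refl)) ¬indep

  step-indep : ∀ {σ} v r → IsIndep Φ σ → IsIndep Φ (step Φ σ v r)
  step-indep {σ} v r indep with stepView σ v r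
  ... | accepted indep′ eq = subst (IsIndep Φ) (sym eq) indep′
  ... | rejected _ eq = subst (IsIndep Φ) (sym eq) indep

  step-⊑-update : ∀ {σ} v r → IsIndep Φ σ → step Φ σ v r ⊑ update σ v r
  step-⊑-update {σ} v false indep rewrite step-false v indep = λ _ σw≡true → σw≡true
  step-⊑-update {σ} v true indep with stepView σ v true
  ... | accepted _ eq rewrite eq = λ _ σw≡true → σw≡true
  ... | rejected _ eq rewrite eq = ⊑-update-true σ v

  step-⊑ : ∀ {σ ρ} v r → IsIndep Φ σ → σ ⊑ ρ → step Φ σ v r ⊑ update ρ v r
  step-⊑ v r indep σ⊑ρ w = update-mono v r σ⊑ρ w ∘ step-⊑-update v r indep w

  SeparatedBy : Coloring n → Coloring n → Subset n → Fin n → Set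
  SeparatedBy σ τ C v = (AllOnesExcept σ C v × ¬ AllOnesExcept τ C v)
                      ⊎ (AllOnesExcept τ C v × ¬ AllOnesExcept σ C v)

  SeparatingEdge : Coloring n → Coloring n → Coloring n → Fin n → Set
  SeparatingEdge σ τ ρ v = ∃ λ C → C ∈ₗ edges Φ × v ∈ C × SeparatedBy σ τ C v × AllOnesOn ρ C

  SeparatingEdge-sym : ∀ {σ τ ρ v} → SeparatingEdge σ τ ρ v → SeparatingEdge τ σ ρ v
  SeparatingEdge-sym (C , C∈Φ , v∈C , inj₁ sep , ones) = C , C∈Φ , v∈C , inj₂ sep , ones
  SeparatingEdge-sym (C , C∈Φ , v∈C , inj₂ sep , ones) = C , C∈Φ , v∈C , inj₁ sep , ones

  rejection⇒separating-edge : ∀ {σ τ ρ v} →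
    IsIndep Φ σ → ¬ IsIndep Φ (update σ v true) → IsIndep Φ τ → τ v ≡ true → σ ⊑ ρ →
    SeparatingEdge σ τ (update ρ v true) v
  rejection⇒separating-edge {σ} {τ} {ρ} {v} σ-indep σ-rejected τ-indep τv≡true σ⊑ρ
    with ¬indep⇒all-ones-edge σ-rejected
  ... | C , C∈Φ , ones = C , C∈Φ , v∈C , inj₁ (σ-ones , τ-not-ones) , ρ-ones
    where
    σ-ones : AllOnesExcept σ C v
    σ-ones w w∈C w≢v = trans (sym (update-other σ true w≢v)) (ones w w∈C)

    v∈C : v ∈ C
    v∈C with All.lookup σ-indep C∈Φ
    ... | u , u∈C , σu≡false with u ≟ v
    ...   | yes refl = u∈C
    ...   | no u≢v = contradiction (trans (sym (σ-ones u u∈C u≢v)) σu≡false) (λ ())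

    τ-not-ones : ¬ AllOnesExcept τ C v
    τ-not-ones τ-ones with All.lookup τ-indep C∈Φ
    ... | u , u∈C , τu≡false with u ≟ v
    ...   | yes refl = contradiction (trans (sym τv≡true) τu≡false) (λ ())
    ...   | no u≢v = contradiction (trans (sym (τ-ones u u∈C u≢v)) τu≡false) (λ ())

    ρ-ones : AllOnesOn (update ρ v true) C
    ρ-ones w w∈C = update-mono v true σ⊑ρ w (ones w w∈C)

  step-disagreement⇒separating-edge : ∀ {σ τ ρ} v r →
    IsIndep Φ σ → IsIndep Φ τ → σ ⊑ ρ → τ ⊑ ρ → step Φ σ v r v ≢ step Φ τ v r v →
    SeparatingEdge (step Φ σ v r) (step Φ τ v r) (update ρ v r) v
  step-disagreement⇒separating-edge {σ} {τ} v false σ-indep τ-indep _ _ differ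
    rewrite step-false v σ-indep | step-false v τ-indep
    = contradiction (trans (update-same σ v false) (sym (update-same τ v false))) differ
  step-disagreement⇒separating-edge {σ} {τ} v true σ-indep τ-indep σ⊑ρ τ⊑ρ differ
    with stepView σ v true | stepView τ v true
  ... | accepted _ eσ | accepted _ eτ rewrite eσ | eτ
    = contradiction (trans (update-same σ v true) (sym (update-same τ v true))) differ
  ... | rejected σ-rej eσ | rejected τ-rej eτ rewrite eσ | eτ
    = contradiction (trans (rejected⇒false σ-indep σ-rej) (sym (rejected⇒false τ-indep τ-rej)))
                    differ
  ... | rejected σ-rej eσ | accepted τ-acc eτ rewrite eσ | eτ
    = rejection⇒separating-edge σ-indep σ-rej τ-acc (update-same τ v true) σ⊑ρ
  ... | accepted σ-acc eσ | rejected τ-rej eτ rewrite eσ | eτ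
    = SeparatingEdge-sym
        (rejection⇒separating-edge τ-indep τ-rej σ-acc (update-same σ v true) τ⊑ρ)

module _ {n : ℕ} .{{_ : NonZero n}} (Φ : Hypergraph n) where

  run-disagreement⇒separating-edge : ∀ i {j} σ τ ρ r rs → length rs + i ≡ j →
    IsIndep Φ σ → IsIndep Φ τ → σ ⊑ ρ → τ ⊑ ρ →
    Fᵢ Φ i σ (r ∷ rs) (scan n j) ≢ Fᵢ Φ i τ (r ∷ rs) (scan n j) →
    SeparatingEdge Φ (Fᵢ Φ i σ (r ∷ rs)) (Fᵢ Φ i τ (r ∷ rs)) (Yᵢ i ρ (r ∷ rs)) (scan n j)
  run-disagreement⇒separating-edge i σ τ ρ r [] refl σ-indep τ-indep σ⊑ρ τ⊑ρ =
    step-disagreement⇒separating-edge Φ (scan n i) r σ-indep τ-indep σ⊑ρ τ⊑ρ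
  run-disagreement⇒separating-edge i σ τ ρ r (r′ ∷ rs) refl σ-indep τ-indep σ⊑ρ τ⊑ρ =
    run-disagreement⇒separating-edge (suc i)
      (step Φ σ v r) (step Φ τ v r) (update ρ v r) r′ rs
      (+-suc (length rs) i) (step-indep Φ v r σ-indep) (step-indep Φ v r τ-indep)
      (step-⊑ Φ v r σ-indep σ⊑ρ) (step-⊑ Φ v r τ-indep τ⊑ρ)
    where v = scan n i

proposition3p4 : (n : ℕ) .{{_ : NonZero n}} (Φ : Hypergraph n) (T : ℕ) (R : Vec Bool T)
    (t : ℕ) → 1 ≤ t → t ≤ T →
    (σ τ : Coloring n) → IsIndep Φ σ → IsIndep Φ τ →
    ¬ (F Φ σ (take t (toList R)) (scan n t) ≡ F Φ τ (take t (toList R)) (scan n t)) →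
    ∃ λ C → C ∈ₗ edges Φ × scan n t ∈ C ×
      ((AllOnesExcept (F Φ σ (take t (toList R))) C (scan n t)
          × ¬ AllOnesExcept (F Φ τ (take t (toList R))) C (scan n t))
       ⊎ (AllOnesExcept (F Φ τ (take t (toList R))) C (scan n t)
          × ¬ AllOnesExcept (F Φ σ (take t (toList R))) C (scan n t)))
      × (∀ w → w ∈ C → Y {n} (take t (toList R)) w ≡ true)
proposition3p4 n Φ _ (r ∷ R) (suc k) (s≤s z≤n) (s≤s k≤T) σ τ σ-indep τ-indep =
  run-disagreement⇒separating-edge Φ 1 σ τ all-ones r (take k (toList R)) last-index
    σ-indep τ-indep (⊑-all-ones σ) (⊑-all-ones τ)
  where
  all-ones : Coloring n
  all-ones _ = true

  ⊑-all-ones : (σ : Coloring n) → σ ⊑ all-ones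
  ⊑-all-ones _ _ _ = refl

  last-index : length (take k (toList R)) + 1 ≡ suc k
  last-index = trans (+-comm _ 1) (cong suc (length-take-toList k≤T R))
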